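{- Fix an integer $r\ge 2$. For $2r\le n\le r^2+1$, $\alpha'(H_{n:r})=r\binom{n-1}{r}$ and $\mathcal{T}_n(1)$ is an independent set of $H_{n:r}$ of this size. For $n\ge r^2$, \[\alpha'(H_{n:r})=\binom{n}{r+1}+\frac{r-1}{r+1}\binom{r^2}{r},\] and \[\Big(\bigcup_{i=r^2+1}^{n}\mathcal{H}_i(i)\Big)\cup\mathcal{T}_{r^2}(1)\] is an independent set of $H_{n:r}$ of this size.
   Context: For positive integers $n,r$ write $[n]=\{1,\dots,n\}$. The Häggkvist–Hell graph $H_{n:r}$ is the graph whose vertices are the ordered pairs $(h,T)$ where $T$ is an $r$-element subset of $[n]$ and $h\in[n]\setminus T$; two vertices $(h_x,T_x)$ and $(h_y,T_y)$ are adjacent iff $h_x\in T_y$, $h_y\in T_x$ and $T_x\cap T_y=\varnothing$. For $i\le n$, $H_{i:r}$ is the induced subgraph of $H_{n:r}$ on vertices using only elements of $[i]$. For fixed $r$ define $\mathcal{H}_i(j)=\{(h,T)\in V(H_{i:r}): h=j\}$ and $\mathcal{T}_i(j)=\{(h,T)\in V(H_{i:r}): j\in T\}$. Define $\alpha'(H_{2r:r})=|\mathcal{T}_{2r}(2r)|$ and, for $n>2r$, recursively \[\alpha'(H_{n:r})=\max\left\{r\binom{n-1}{r},\ \binom{n-1}{r}+\alpha'(H_{n-1:r})\right\}\] (note $|\mathcal{T}_n(n)|=r\binom{n-1}{r}$ and $|\mathcal{H}_n(n)|=\binom{n-1}{r}$). -}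

module Defs where

open import Data.Nat using (ℕ; zero; suc; _+_; _*_; _∸_; _<_; _≤_; _⊔_)
open import Data.Nat.Combinatorics using (_C_)
open import Data.Fin using (Fin; toℕ)
open import Data.Fin.Subset using (Subset; _∈_; _∩_; ∣_∣; Empty; outside)
open import Data.Vec.Relation.Unary.Any using ()
open import Data.Vec using (_[_]=_)
open import Data.Product using (Σ; _×_; ∃)
open import Data.Empty using (⊥)
open import Data.List using (List; length)
open import Data.List.Relation.Unary.Unique.Propositional using (Unique)
import Data.List.Membership.Propositional as LM
open import Relation.Binary.PropositionalEquality using (_≡_)
open import Relation.Nullary using (¬_)
open import Function.Bundles using (_⇔_)

-- Elements of [n] = {1,…,n} are represented by Fin n; the element k ∈ [n]
-- is the index i : Fin n with toℕ i + 1 ≡ k.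

-- A vertex (h , T) of the Häggkvist–Hell graph H_{n:r}.
-- The side conditions are stated with proof-irrelevant (data / ≡ on ℕ) types
-- so that vertices are determined by (h , T).
record Vertex (n r : ℕ) : Set where
  constructor vtx
  field
    h     : Fin n
    T     : Subset n
    cardT : ∣ T ∣ ≡ r
    h∉T   : T [ h ]= outside
open Vertex public

Adjacent : ∀ {n r} → Vertex n r → Vertex n r → Set
Adjacent x y = (h x ∈ T y) × (h y ∈ T x) × Empty (T x ∩ T y)

-- Vertex uses only elements of [i] (i.e. it is a vertex of H_{i:r} ⊆ H_{n:r}).
UsesOnly : ∀ {n r} → ℕ → Vertex n r → Set
UsesOnly i v = (toℕ (h v) < i) × (∀ x → x ∈ T v → toℕ x < i)

HSet : ∀ {n r} → ℕ → ℕ → Vertex n r → Set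
HSet i j v = UsesOnly i v × (toℕ (h v) + 1 ≡ j)

TSet : ∀ {n r} → ℕ → ℕ → Vertex n r → Set
TSet {n} i j v = UsesOnly i v × Σ (Fin n) (λ x → (x ∈ T v) × (toℕ x + 1 ≡ j))

Independent : ∀ {n r} → (Vertex n r → Set) → Set
Independent P = ∀ x y → P x → P y → ¬ Adjacent x y

HasSize : ∀ {n r} → (Vertex n r → Set) → ℕ → Set
HasSize {n} {r} P k =
  Σ (List (Vertex n r)) λ xs → Unique xs × (∀ v → (v LM.∈ xs) ⇔ P v) × (length xs ≡ k)

-- α'(H_{(2r+k):r}) by recursion on k, following the paper's definition
-- (base value |𝓣_{2r}(2r)| = r·C(2r-1, r)).
α'aux : ℕ → ℕ → ℕ
α'aux r zero    = r * ((2 * r ∸ 1) C r)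
α'aux r (suc k) = (r * ((2 * r + k) C r)) ⊔ (((2 * r + k) C r) + α'aux r k)

α' : ℕ → ℕ → ℕ
α' r n = α'aux r (n ∸ 2 * r)

module Submission where

-- Everything rests on the absorption identity (k+1)·C(N,k+1) = (N−k)·C(N,k),
-- which says C(N,r)/C(N,r−1) ≤ r−1 exactly when N ≤ r²−1.  In the recursion
-- α'(j+1) = max(r·C(j,r), C(j,r) + α'(j)) this decides which term wins: up to j = r² the
-- first one, so α'(n) = r·C(n−1,r); from j = r² on the second one, which is proved by
-- carrying the invariant (r−1)·C(j,r) ≤ α'(j), and summing the increments C(j,r) by
-- Pascal's rule gives the closed form (r+1)·α'(n) = (r+1)·C(n,r+1) + (r−1)·C(r²,r).
--
-- Splitting vertices of H_{n+1:k} by the role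
-- of the element 1 (head, in the tail, unused) counts the vertices of H_{p:k}, then
-- 𝓣_{m+1}(1) and 𝓗_{j+1}(j+1).  𝓣_m(1) is independent since all tails contain 1, and
-- adjoining the layers 𝓗_i(i), i > r², keeps independence because a head i never lies
-- in a tail drawn from [i−1].

open import Defs
open import Data.Nat using (ℕ; zero; suc; _+_; _*_; _∸_; _≤_; _<_; _^_; _⊔_; z≤n; s≤s; _≤′_; ≤′-refl; ≤′-reflexive; ≤′-step)
open import Data.Nat.Properties
open import Data.Nat.Combinatorics using (_C_; nC1≡n; nCk+nC[k+1]≡[n+1]C[k+1])
open import Data.Nat.Tactic.RingSolver using (solve-∀)
open import Data.Fin as Fin using (Fin; toℕ)
open import Data.Fin.Properties using (toℕ-injective) renaming (suc-injective to fsuc-injective)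
open import Data.Fin.Subset using (Subset; Side; _∈_; ∣_∣; outside; inside) renaming (⊥ to ∅)
open import Data.Fin.Subset.Properties using (x∈p∩q⁺; ∉⊥; ∣⊥∣≡0)
open import Data.Vec using ([]; _∷_; _[_]=_; here; there)
open import Data.Vec.Properties using (∷-injectiveʳ; []=-injective)
open import Data.List using (List; []; _∷_; _++_; map; length)
open import Data.List.Properties using (length-map; length-++)
open import Data.List.Relation.Unary.Unique.Propositional using (Unique)
open import Data.List.Relation.Unary.AllPairs using ([]; _∷_)
open import Data.List.Relation.Unary.All using ([])
import Data.List.Relation.Unary.Unique.Propositional.Properties as Unique
import Data.List.Membership.Propositional as List
open import Data.List.Membership.Propositional.Properties using (∈-map⁺; ∈-map⁻; ∈-++⁺ˡ; ∈-++⁺ʳ; ∈-++⁻)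
open import Data.List.Relation.Unary.Any using (here)
open import Data.Product using (Σ; _×_; _,_; proj₁; proj₂)
open import Data.Sum using (_⊎_; inj₁; inj₂)
open import Data.Empty using (⊥; ⊥-elim)
open import Relation.Nullary using (¬_)
open import Relation.Binary.PropositionalEquality
open import Function using (_∘_)
open import Function.Bundles using (_⇔_; mk⇔; Equivalence)
open Equivalence using (to; from)

pascal : ∀ n k → suc n C suc k ≡ n C k + n C suc k
pascal n k = sym (nCk+nC[k+1]≡[n+1]C[k+1] n k)

-- The absorption identity (k+1)·C(N,k+1) = (N−k)·C(N,k), written without subtraction.
absorption : ∀ N k → suc k * (N C suc k) + k * (N C k) ≡ N * (N C k)
absorption zero    zero    = refl
absorption zero    (suc k) = cong₂ _+_ (*-zeroʳ (suc (suc k))) (*-zeroʳ (suc k))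
absorption (suc N) zero    = begin
  1 * (suc N C 1) + 0  ≡⟨ +-identityʳ _ ⟩
  1 * (suc N C 1)      ≡⟨ *-identityˡ _ ⟩
  suc N C 1            ≡⟨ nC1≡n (suc N) ⟩
  suc N                ≡⟨ *-identityʳ (suc N) ⟨
  suc N * 1            ∎
  where open ≡-Reasoning
absorption (suc N) (suc k) = begin
  suc (suc k) * (suc N C suc (suc k)) + suc k * (suc N C suc k)
    ≡⟨ cong₂ (λ x y → suc (suc k) * x + suc k * y) (pascal N (suc k)) (pascal N k) ⟩
  suc (suc k) * (a′ + b) + suc k * (a + a′)
    ≡⟨ regroup k a a′ b ⟩
  (suc (suc k) * b + suc k * a′) + (suc k * a′ + k * a) + a′ + a
    ≡⟨ cong₂ (λ x y → x + y + a′ + a) (absorption N (suc k)) (absorption N k) ⟩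
  N * a′ + N * a + a′ + a
    ≡⟨ collect N a a′ ⟩
  suc N * (a + a′)
    ≡⟨ cong (suc N *_) (pascal N k) ⟨
  suc N * (suc N C suc k) ∎
  where
  open ≡-Reasoning
  a = N C k
  a′ = N C suc k
  b = N C suc (suc k)
  regroup : ∀ k a a′ b → suc (suc k) * (a′ + b) + suc k * (a + a′)
                       ≡ (suc (suc k) * b + suc k * a′) + (suc k * a′ + k * a) + a′ + a
  regroup = solve-∀
  collect : ∀ N a a′ → N * a′ + N * a + a′ + a ≡ suc N * (a + a′)
  collect = solve-∀

-- s(s+2)·Y = (s+1)·(s·Y) + s·Y, comparing N·Y with (s+1)·(s·Y) in the ratio lemmas.
square-split : ∀ s Y → s * (s + 2) * Y ≡ suc s * (s * Y) + s * Y
square-split = solve-∀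

-- With absorption at k = s, the ratio C(N,s+1)/C(N,s) = (N−s)/(s+1) is at most s
-- exactly when N ≤ s(s+2) = (s+1)² − 1.  Both directions are needed.
ratio-≤ : ∀ N s → N ≤ s * (s + 2) → N C suc s ≤ s * (N C s)
ratio-≤ N s N≤ = *-cancelˡ-≤ (suc s) (+-cancelʳ-≤ (s * Y) _ _ (begin
  suc s * X + s * Y        ≡⟨ absorption N s ⟩
  N * Y                    ≤⟨ *-monoˡ-≤ Y N≤ ⟩
  s * (s + 2) * Y          ≡⟨ square-split s Y ⟩
  suc s * (s * Y) + s * Y  ∎))
  where
  open ≤-Reasoning
  X = N C suc s
  Y = N C s

ratio-≥ : ∀ N s → s * (s + 2) ≤ N → s * (N C s) ≤ N C suc s
ratio-≥ N s ≤N = *-cancelˡ-≤ (suc s) (+-cancelʳ-≤ (s * Y) _ _ (begin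
  suc s * (s * Y) + s * Y  ≡⟨ square-split s Y ⟨
  s * (s + 2) * Y          ≤⟨ *-monoˡ-≤ Y ≤N ⟩
  N * Y                    ≡⟨ absorption N s ⟨
  suc s * X + s * Y        ∎))
  where
  open ≤-Reasoning
  X = N C suc s
  Y = N C s

-- (s+1)² = s(s+2) + 1: translates between r² and the threshold r² − 1 = s(s+2).
square-suc : ∀ s → suc s ^ 2 ≡ suc (s * (s + 2))
square-suc s = expand s
  where
  expand : ∀ s → suc s * (suc s * 1) ≡ suc (s * (s + 2))
  expand = solve-∀

α'-base : ∀ r → α' r (2 * r) ≡ r * ((2 * r ∸ 1) C r)
α'-base r = cong (α'aux r) (n∸n≡0 (2 * r))

α'-step : ∀ r j → 2 * r ≤ j → α' r (suc j) ≡ (r * (j C r)) ⊔ ((j C r) + α' r j)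
α'-step r j 2r≤j = begin
  α'aux r (suc j ∸ 2 * r)   ≡⟨ cong (α'aux r) (+-∸-assoc 1 2r≤j) ⟩
  α'aux r (suc (j ∸ 2 * r)) ≡⟨ cong (λ m → r * (m C r) ⊔ ((m C r) + α' r j)) (m+[n∸m]≡n 2r≤j) ⟩
  (r * (j C r)) ⊔ ((j C r) + α' r j) ∎
  where open ≡-Reasoning

-- While N ≤ r² − 1, the second candidate C(N+1,r) + r·C(N,r) never beats r·C(N+1,r);
-- by Pascal this is the inequality C(N,r) ≤ (r−1)·C(N,r−1) of ratio-≤.
first-term-wins : ∀ s N → N ≤ s * (s + 2) → suc N C suc s + suc s * (N C suc s) ≤ suc s * (suc N C suc s)
first-term-wins s N N≤ = begin
  suc N C suc s + suc s * b        ≡⟨ cong (λ x → x + suc s * b) (pascal N s) ⟩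
  (a + b) + suc s * b              ≡⟨ regroup s a b ⟩
  (a + suc s * b) + b              ≤⟨ +-monoʳ-≤ (a + suc s * b) (ratio-≤ N s N≤) ⟩
  (a + suc s * b) + s * a          ≡⟨ collect s a b ⟩
  suc s * (a + b)                  ≡⟨ cong (suc s *_) (pascal N s) ⟨
  suc s * (suc N C suc s)          ∎
  where
  open ≤-Reasoning
  a = N C s
  b = N C suc s
  regroup : ∀ s a b → (a + b) + suc s * b ≡ (a + suc s * b) + b
  regroup = solve-∀
  collect : ∀ s a b → (a + suc s * b) + s * a ≡ suc s * (a + b)
  collect = solve-∀

α'-below-square : ∀ {s n} → 2 * suc s ≤′ n → n ≤ suc (suc (s * (s + 2))) →
                  α' (suc s) n ≡ suc s * ((n ∸ 1) C suc s)
α'-below-square {s} ≤′-refl _ = α'-base (suc s)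
α'-below-square {s} {suc zero} (≤′-step (≤′-reflexive ()))
α'-below-square {s} {suc (suc N)} (≤′-step 2r≤N+1) n≤ = begin
  α' r (suc (suc N))
    ≡⟨ α'-step r (suc N) (≤′⇒≤ 2r≤N+1) ⟩
  r * (suc N C r) ⊔ (suc N C r + α' r (suc N))
    ≡⟨ cong (λ x → r * (suc N C r) ⊔ (suc N C r + x)) (α'-below-square 2r≤N+1 (m≤n⇒m≤1+n (≤-pred n≤))) ⟩
  r * (suc N C r) ⊔ (suc N C r + r * (N C r))
    ≡⟨ m≥n⇒m⊔n≡m (first-term-wins s N (≤-pred (≤-pred n≤))) ⟩
  r * (suc N C r) ∎
  where
  open ≡-Reasoning
  r = suc s

α'-up-to-square : ∀ s n → 2 * suc s ≤ n → n ≤ suc s ^ 2 + 1 → α' (suc s) n ≡ suc s * ((n ∸ 1) C suc s)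
α'-up-to-square s n 2r≤n n≤ =
  α'-below-square (≤⇒≤′ 2r≤n) (subst (n ≤_) (trans (cong (_+ 1) (square-suc s)) (+-comm _ 1)) n≤)

second-term-wins : ∀ s j → 2 * suc s ≤ j → s * (j C suc s) ≤ α' (suc s) j →
                   α' (suc s) (suc j) ≡ j C suc s + α' (suc s) j
second-term-wins s j 2r≤j dominated = begin
  α' r (suc j)                       ≡⟨ α'-step r j 2r≤j ⟩
  (r * (j C r)) ⊔ ((j C r) + α' r j) ≡⟨ m≤n⇒m⊔n≡n (+-monoʳ-≤ (j C r) dominated) ⟩
  (j C r) + α' r j                   ∎
  where
  open ≡-Reasoning
  r = suc s

-- The regime n ≥ r², for r = t + 2 ≥ 2 (so that r² ≥ 2r and α' is defined at r²).
-- Writing M = r² − 1 = s(s+2), we show by induction from n = r² that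
-- (r−1)·C(n,r) ≤ α'(n), hence α'(n+1) = C(n,r) + α'(n), hence the closed form.
module AboveSquare (t : ℕ) where
  s = suc t
  r = suc s
  M = s * (s + 2)  -- r² − 1

  -- r ≥ 2 gives 2r ≤ r², so r² lies in the range where α' is defined.
  2r≤r² : 2 * r ≤ suc M
  2r≤r² = subst (2 * r ≤_) (sym (expand t)) (m≤m+n (2 * r) (t * t + 2 * t))
    where
    expand : ∀ t → suc (suc t * (suc t + 2)) ≡ 2 * suc (suc t) + (t * t + 2 * t)
    expand = solve-∀

  α'-at-square : α' r (suc M) ≡ r * (M C r)
  α'-at-square = α'-below-square (≤⇒≤′ 2r≤r²) (n≤1+n (suc M))

  balanced : M C r ≡ s * (M C s)
  balanced = ≤-antisym (ratio-≤ M s ≤-refl) (ratio-≥ M s ≤-refl)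

  -- The invariant (r−1)·C(j,r) ≤ α'(j) for j ≥ r²: equality at r² by balanced, and
  -- each step adds (r−1)·C(j,r−1) ≤ C(j,r) to the left and C(j,r) to the right.
  dominated : ∀ {j} → suc M ≤′ j → s * (j C r) ≤ α' r j
  dominated ≤′-refl = ≤-reflexive (begin
    s * (suc M C r)                  ≡⟨ cong (s *_) (pascal M s) ⟩
    s * (M C s + M C r)              ≡⟨ *-distribˡ-+ s (M C s) (M C r) ⟩
    s * (M C s) + s * (M C r)        ≡⟨ cong (_+ s * (M C r)) balanced ⟨
    M C r + s * (M C r)              ≡⟨⟩
    r * (M C r)                      ≡⟨ α'-at-square ⟨
    α' r (suc M)                     ∎)
    where open ≡-Reasoning
  dominated {suc j} (≤′-step r²≤j) = begin
    s * (suc j C r)                  ≡⟨ cong (s *_) (pascal j s) ⟩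
    s * (j C s + j C r)              ≡⟨ *-distribˡ-+ s (j C s) (j C r) ⟩
    s * (j C s) + s * (j C r)        ≤⟨ +-mono-≤ (ratio-≥ j s (≤-trans (n≤1+n M) (≤′⇒≤ r²≤j))) (dominated r²≤j) ⟩
    j C r + α' r j                   ≡⟨ second-term-wins s j (≤-trans 2r≤r² (≤′⇒≤ r²≤j)) (dominated r²≤j) ⟨
    α' r (suc j)                     ∎
    where open ≤-Reasoning

  grows : ∀ {j} → suc M ≤′ j → α' r (suc j) ≡ j C r + α' r j
  grows {j} r²≤j = second-term-wins s j (≤-trans 2r≤r² (≤′⇒≤ r²≤j)) (dominated r²≤j)

  closed-form : ∀ {j} → suc M ≤′ j → suc r * α' r j ≡ suc r * (j C suc r) + s * (suc M C r)
  closed-form ≤′-refl = begin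
    suc r * α' r (suc M)                         ≡⟨ cong (suc r *_) α'-at-square ⟩
    suc r * (r * Y)                              ≡⟨ gather s Y ⟨
    M * Y + Y + r * Y                            ≡⟨ cong₂ (λ x y → x + y + r * Y) (absorption M r) (sym balanced) ⟨
    (suc r * W + r * Y) + s * Z + r * Y          ≡⟨ regroup s Y Z W ⟨
    suc r * (Y + W) + s * (Z + Y)                ≡⟨ cong₂ (λ x y → suc r * x + s * y) (pascal M r) (pascal M s) ⟨
    suc r * (suc M C suc r) + s * (suc M C r)    ∎
    where
    open ≡-Reasoning
    Y = M C r
    Z = M C s
    W = M C suc r
    gather : ∀ s Y → s * (s + 2) * Y + Y + suc s * Y ≡ suc (suc s) * (suc s * Y)
    gather = solve-∀
    regroup : ∀ s Y Z W → suc (suc s) * (Y + W) + s * (Z + Y)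
                        ≡ (suc (suc s) * W + suc s * Y) + s * Z + suc s * Y
    regroup = solve-∀
  closed-form {suc j} (≤′-step r²≤j) = begin
    suc r * α' r (suc j)                         ≡⟨ cong (suc r *_) (grows r²≤j) ⟩
    suc r * (j C r + α' r j)                     ≡⟨ *-distribˡ-+ (suc r) (j C r) (α' r j) ⟩
    suc r * (j C r) + suc r * α' r j             ≡⟨ cong (suc r * (j C r) +_) (closed-form r²≤j) ⟩
    suc r * (j C r) + (suc r * (j C suc r) + K)  ≡⟨ +-assoc (suc r * (j C r)) _ K ⟨
    suc r * (j C r) + suc r * (j C suc r) + K    ≡⟨ cong (_+ K) (*-distribˡ-+ (suc r) (j C r) (j C suc r)) ⟨
    suc r * (j C r + j C suc r) + K              ≡⟨ cong (λ x → suc r * x + K) (pascal j r) ⟨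
    suc r * (suc j C suc r) + K                  ∎
    where
    open ≡-Reasoning
    K = s * (suc M C r)

  α'-grows : ∀ j → r ^ 2 ≤ j → α' r (suc j) ≡ α' r j + j C r
  α'-grows j r²≤j = trans (grows (≤⇒≤′ (subst (_≤ j) (square-suc s) r²≤j))) (+-comm (j C r) (α' r j))

  α'-above-square : ∀ n → r ^ 2 ≤ n →
                    (r + 1) * α' r n ≡ (r + 1) * (n C (r + 1)) + (r ∸ 1) * ((r ^ 2) C r)
  α'-above-square n r²≤n =
    subst₂ (λ q R → q * α' r n ≡ q * (n C q) + s * (R C r)) (+-comm 1 r) (sym (square-suc s))
      (closed-form (≤⇒≤′ (subst (_≤ n) (square-suc s) r²≤n)))

Enum : {A : Set} → (A → Set) → ℕ → Set
Enum {A} P k = Σ (List A) λ xs → Unique xs × (∀ v → (v List.∈ xs) ⇔ P v) × (length xs ≡ k)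

Image : {A B : Set} → (A → B) → (A → Set) → B → Set
Image {A} f P b = Σ A λ a → P a × b ≡ f a

module _ {A : Set} where

  enum-cong : ∀ {P Q : A → Set} {k k′} → Enum P k →
              (∀ v → P v → Q v) → (∀ v → Q v → P v) → k ≡ k′ → Enum Q k′
  enum-cong (xs , uniq , mem , len) P⇒Q Q⇒P k≡k′ =
    xs , uniq , (λ v → mk⇔ (λ i → P⇒Q v (to (mem v) i)) (λ q → from (mem v) (Q⇒P v q))) , trans len k≡k′

  enum-none : ∀ {P : A → Set} → (∀ v → ¬ P v) → Enum P 0
  enum-none ¬P = [] , [] , (λ v → mk⇔ (λ ()) (λ p → ⊥-elim (¬P v p))) , refl

  enum-single : (a : A) → Enum (λ v → v ≡ a) 1
  enum-single a = a ∷ [] , [] ∷ [] , (λ v → mk⇔ (λ { (here e) → e }) here) , refl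

  enum-⊎ : ∀ {P Q : A → Set} {a b} → (∀ v → P v → Q v → ⊥) →
           Enum P a → Enum Q b → Enum (λ v → P v ⊎ Q v) (a + b)
  enum-⊎ {P} {Q} disjoint (xs , uxs , mxs , lxs) (ys , uys , mys , lys) =
    xs ++ ys ,
    Unique.++⁺ uxs uys (λ {v} (i , j) → disjoint v (to (mxs v) i) (to (mys v) j)) ,
    (λ v → mk⇔ (λ i → split v (∈-++⁻ xs i)) (join v)) ,
    trans (length-++ xs) (cong₂ _+_ lxs lys)
    where
    split : ∀ v → (v List.∈ xs) ⊎ (v List.∈ ys) → P v ⊎ Q v
    split v (inj₁ i) = inj₁ (to (mxs v) i)
    split v (inj₂ j) = inj₂ (to (mys v) j)
    join : ∀ v → P v ⊎ Q v → v List.∈ xs ++ ys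
    join v (inj₁ p) = ∈-++⁺ˡ (from (mxs v) p)
    join v (inj₂ q) = ∈-++⁺ʳ xs (from (mys v) q)

enum-image : {A B : Set} {P : A → Set} {k : ℕ} (f : A → B) →
             (∀ {x y} → f x ≡ f y → x ≡ y) → Enum P k → Enum (Image f P) k
enum-image {A} {P = P} f f-inj (xs , uniq , mem , len) =
  map f xs , Unique.map⁺ f-inj uniq ,
  (λ v → mk⇔ (λ i → pull v (∈-map⁻ f i)) (λ { (a , p , refl) → ∈-map⁺ f (from (mem a) p) })) ,
  trans (length-map f xs) len
  where
  pull : ∀ v → Σ A (λ x → x List.∈ xs × v ≡ f x) → Image f P v
  pull v (a , i , e) = a , to (mem a) i , e

-- k-element subsets of [n].  The cardinality proof is irrelevant (≡ on ℕ),
-- so such a subset is determined by its characteristic vector.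
Sub : ℕ → ℕ → Set
Sub n k = Σ (Subset n) λ T → ∣ T ∣ ≡ k

sub-≡ : ∀ {n k} {s t : Sub n k} → proj₁ s ≡ proj₁ t → s ≡ t
sub-≡ {s = T , c} {T , d} refl = cong (T ,_) (≡-irrelevant c d)

add-first : ∀ {n k} → Sub n k → Sub (suc n) (suc k)
add-first (T , c) = inside ∷ T , cong suc c

skip-first : ∀ {n k} → Sub n k → Sub (suc n) k
skip-first (T , c) = outside ∷ T , c

add-first-injective : ∀ {n k} {s t : Sub n k} → add-first s ≡ add-first t → s ≡ t
add-first-injective e = sub-≡ (∷-injectiveʳ (cong proj₁ e))

skip-first-injective : ∀ {n k} {s t : Sub n k} → skip-first s ≡ skip-first t → s ≡ t
skip-first-injective e = sub-≡ (∷-injectiveʳ (cong proj₁ e))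

first-bit : ∀ {n} → Subset (suc n) → Side
first-bit (b ∷ _) = b

add≢skip : ∀ {n k} {s : Sub n k} {t : Sub n (suc k)} → add-first s ≢ skip-first t
add≢skip e with cong (first-bit ∘ proj₁) e
... | ()

data SubView {n} : ∀ {k} → Sub (suc n) k → Set where
  added   : ∀ {k} (s : Sub n k) → SubView (add-first s)
  skipped : ∀ {k} (s : Sub n k) → SubView (skip-first s)

sub-view : ∀ {n k} (s : Sub (suc n) k) → SubView s
sub-view (inside ∷ T , refl) = added (T , refl)
sub-view (outside ∷ T , c)   = skipped (T , c)

Within : ∀ {n} → ℕ → Subset n → Set
Within p T = ∀ x → x ∈ T → toℕ x < p

within-rest : ∀ {n p b} {T : Subset n} → Within (suc p) (b ∷ T) → Within p T
within-rest w x x∈T = ≤-pred (w (Fin.suc x) (there x∈T))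

within-cons : ∀ {n p b} {T : Subset n} → Within p T → Within (suc p) (b ∷ T)
within-cons w Fin.zero    _           = s≤s z≤n
within-cons w (Fin.suc x) (there x∈T) = s≤s (w x x∈T)

within-zero : ∀ {n} (T : Subset n) → Within 0 T → T ≡ ∅
within-zero []            w = refl
within-zero (inside ∷ T)  w with w Fin.zero here
... | ()
within-zero (outside ∷ T) w = cong (outside ∷_) (within-zero T (λ x x∈T → ⊥-elim (n≮0 (w (Fin.suc x) (there x∈T)))))

SubWithin : ∀ {n k} → ℕ → Sub n k → Set
SubWithin p s = Within p (proj₁ s)

subsets-within : ∀ n p k → p ≤ n → Enum {Sub n k} (SubWithin p) (p C k)
subsets-within n zero zero _ = enum-cong (enum-single (∅ , ∣⊥∣≡0 n)) only-∅ is-∅ refl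
  where
  only-∅ : ∀ s → s ≡ (∅ , ∣⊥∣≡0 n) → SubWithin 0 s
  only-∅ s refl x x∈⊥ = ⊥-elim (∉⊥ x∈⊥)
  is-∅ : ∀ s → SubWithin 0 s → s ≡ (∅ , ∣⊥∣≡0 n)
  is-∅ (T , _) w = sub-≡ (within-zero T w)
subsets-within n zero (suc k) _ = enum-none nonempty
  where
  nonempty : ∀ (s : Sub n (suc k)) → ¬ SubWithin 0 s
  nonempty (T , c) w with trans (trans (sym (∣⊥∣≡0 n)) (cong ∣_∣ (sym (within-zero T w)))) c
  ... | ()
subsets-within zero (suc p) k ()
subsets-within (suc n) (suc p) zero (s≤s p≤n) =
  enum-cong (enum-image skip-first skip-first-injective (subsets-within n p zero p≤n)) into back refl
  where
  into : ∀ s → Image skip-first (SubWithin p) s → SubWithin (suc p) s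
  into _ (s , w , refl) = within-cons w
  back : ∀ s → SubWithin (suc p) s → Image skip-first (SubWithin p) s
  back s w with sub-view s
  ... | skipped s′ = s′ , within-rest w , refl
subsets-within (suc n) (suc p) (suc k) (s≤s p≤n) =
  enum-cong (enum-⊎ disjoint (enum-image add-first add-first-injective (subsets-within n p k p≤n))
                             (enum-image skip-first skip-first-injective (subsets-within n p (suc k) p≤n)))
            into back (nCk+nC[k+1]≡[n+1]C[k+1] p k)
  where
  disjoint : ∀ s → Image add-first (SubWithin p) s → Image skip-first (SubWithin p) s → ⊥
  disjoint _ (_ , _ , refl) (_ , _ , e) = add≢skip e
  into : ∀ s → Image add-first (SubWithin p) s ⊎ Image skip-first (SubWithin p) s → SubWithin (suc p) s
  into _ (inj₁ (_ , w , refl)) = within-cons w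
  into _ (inj₂ (_ , w , refl)) = within-cons w
  back : ∀ s → SubWithin (suc p) s → Image add-first (SubWithin p) s ⊎ Image skip-first (SubWithin p) s
  back s w with sub-view s
  ... | added s′   = inj₁ (s′ , within-rest w , refl)
  ... | skipped s′ = inj₂ (s′ , within-rest w , refl)

outside-irrelevant : ∀ {n} {T : Subset n} {i} (p q : T [ i ]= outside) → p ≡ q
outside-irrelevant here      here      = refl
outside-irrelevant (there p) (there q) = cong there (outside-irrelevant p q)

vertex-≡ : ∀ {n k} {x y : Vertex n k} → h x ≡ h y → T x ≡ T y → x ≡ y
vertex-≡ {x = vtx h₁ T₁ c p} {vtx h₁ T₁ d q} refl refl =
  cong₂ (vtx h₁ T₁) (≡-irrelevant c d) (outside-irrelevant p q)

head-first : ∀ {n k} → Sub n k → Vertex (suc n) k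
head-first (T , c) = vtx Fin.zero (outside ∷ T) c here

tail-first : ∀ {n k} → Vertex n k → Vertex (suc n) (suc k)
tail-first (vtx h T c p) = vtx (Fin.suc h) (inside ∷ T) (cong suc c) (there p)

avoid-first : ∀ {n k} → Vertex n k → Vertex (suc n) k
avoid-first (vtx h T c p) = vtx (Fin.suc h) (outside ∷ T) c (there p)

head-first-injective : ∀ {n k} {s t : Sub n k} → head-first s ≡ head-first t → s ≡ t
head-first-injective e = sub-≡ (∷-injectiveʳ (cong T e))

tail-first-injective : ∀ {n k} {x y : Vertex n k} → tail-first x ≡ tail-first y → x ≡ y
tail-first-injective e = vertex-≡ (fsuc-injective (cong h e)) (∷-injectiveʳ (cong T e))

avoid-first-injective : ∀ {n k} {x y : Vertex n k} → avoid-first x ≡ avoid-first y → x ≡ y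
avoid-first-injective e = vertex-≡ (fsuc-injective (cong h e)) (∷-injectiveʳ (cong T e))

head≢tail : ∀ {n k} {s : Sub n (suc k)} {w : Vertex n k} → head-first s ≢ tail-first w
head≢tail e with cong h e
... | ()

head≢avoid : ∀ {n k} {s : Sub n k} {w : Vertex n k} → head-first s ≢ avoid-first w
head≢avoid e with cong h e
... | ()

tail≢avoid : ∀ {n k} {w : Vertex n k} {w′ : Vertex n (suc k)} → tail-first w ≢ avoid-first w′
tail≢avoid e with cong (first-bit ∘ T) e
... | ()

data VertexView {n} : ∀ {k} → Vertex (suc n) k → Set where
  headed  : ∀ {k} (s : Sub n k) → VertexView (head-first s)
  tailed  : ∀ {k} (w : Vertex n k) → VertexView (tail-first w)
  avoided : ∀ {k} (w : Vertex n k) → VertexView (avoid-first w)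

vertex-view : ∀ {n k} (v : Vertex (suc n) k) → VertexView v
vertex-view (vtx Fin.zero    (b ∷ T)       c    here)      = headed (T , c)
vertex-view (vtx (Fin.suc h) (inside ∷ T)  refl (there p)) = tailed (vtx h T refl p)
vertex-view (vtx (Fin.suc h) (outside ∷ T) c    (there p)) = avoided (vtx h T c p)

uses-head→ : ∀ {n k p} {s : Sub n k} → UsesOnly (suc p) (head-first s) → SubWithin p s
uses-head→ (_ , w) = within-rest w

uses-head← : ∀ {n k p} {s : Sub n k} → SubWithin p s → UsesOnly (suc p) (head-first s)
uses-head← w = s≤s z≤n , within-cons w

uses-tail→ : ∀ {n k p} {w : Vertex n k} → UsesOnly (suc p) (tail-first w) → UsesOnly p w
uses-tail→ (s≤s h<p , w) = h<p , within-rest w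

uses-tail← : ∀ {n k p} {w : Vertex n k} → UsesOnly p w → UsesOnly (suc p) (tail-first w)
uses-tail← (h<p , w) = s≤s h<p , within-cons w

uses-avoid→ : ∀ {n k p} {w : Vertex n k} → UsesOnly (suc p) (avoid-first w) → UsesOnly p w
uses-avoid→ (s≤s h<p , w) = h<p , within-rest w

uses-avoid← : ∀ {n k p} {w : Vertex n k} → UsesOnly p w → UsesOnly (suc p) (avoid-first w)
uses-avoid← (h<p , w) = s≤s h<p , within-cons w

-- H_{p:k} ⊆ H_{n:k} has p·C(p−1,k) = (k+1)·C(p,k+1) vertices: split by the role of element 1.
vertices-within : ∀ n p k → p ≤ n → Enum {Vertex n k} (UsesOnly p) (suc k * (p C suc k))
vertices-within n zero k _ =
  enum-cong (enum-none {P = UsesOnly 0} λ { _ (() , _) }) (λ _ u → u) (λ _ u → u) (sym (*-zeroʳ (suc k)))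
vertices-within zero (suc p) k ()
vertices-within (suc n) (suc p) zero (s≤s p≤n) =
  enum-cong (enum-⊎ disjoint (enum-image head-first head-first-injective (subsets-within n p 0 p≤n))
                             (enum-image avoid-first avoid-first-injective (vertices-within n p 0 p≤n)))
            into back count
  where
  disjoint : ∀ v → Image head-first (SubWithin p) v → Image avoid-first (UsesOnly p) v → ⊥
  disjoint _ (_ , _ , refl) (_ , _ , e) = head≢avoid e
  into : ∀ v → Image head-first (SubWithin p) v ⊎ Image avoid-first (UsesOnly p) v → UsesOnly (suc p) v
  into _ (inj₁ (s , w , refl)) = uses-head← {s = s} w
  into _ (inj₂ (w , u , refl)) = uses-avoid← {w = w} u
  back : ∀ v → UsesOnly (suc p) v → Image head-first (SubWithin p) v ⊎ Image avoid-first (UsesOnly p) v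
  back v u with vertex-view v
  ... | headed s  = inj₁ (s , uses-head→ {s = s} u , refl)
  ... | avoided w = inj₂ (w , uses-avoid→ {w = w} u , refl)
  count : p C 0 + 1 * (p C 1) ≡ 1 * (suc p C 1)
  count = begin
    p C 0 + 1 * (p C 1)  ≡⟨ cong (p C 0 +_) (*-identityˡ (p C 1)) ⟩
    p C 0 + p C 1        ≡⟨ pascal p 0 ⟨
    suc p C 1            ≡⟨ *-identityˡ (suc p C 1) ⟨
    1 * (suc p C 1)      ∎
    where open ≡-Reasoning
vertices-within (suc n) (suc p) (suc k) (s≤s p≤n) =
  enum-cong (enum-⊎ disjoint (enum-image head-first head-first-injective (subsets-within n p (suc k) p≤n))
              (enum-⊎ disjoint′ (enum-image tail-first tail-first-injective (vertices-within n p k p≤n))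
                                (enum-image avoid-first avoid-first-injective (vertices-within n p (suc k) p≤n))))
            into back count
  where
  disjoint′ : ∀ v → Image tail-first (UsesOnly p) v → Image avoid-first (UsesOnly p) v → ⊥
  disjoint′ _ (_ , _ , refl) (_ , _ , e) = tail≢avoid e
  disjoint : ∀ v → Image head-first (SubWithin p) v → Image tail-first (UsesOnly p) v ⊎ Image avoid-first (UsesOnly p) v → ⊥
  disjoint _ (_ , _ , refl) (inj₁ (_ , _ , e)) = head≢tail e
  disjoint _ (_ , _ , refl) (inj₂ (_ , _ , e)) = head≢avoid e
  into : ∀ v → Image head-first (SubWithin p) v ⊎ (Image tail-first (UsesOnly p) v ⊎ Image avoid-first (UsesOnly p) v) → UsesOnly (suc p) v
  into _ (inj₁ (s , w , refl))        = uses-head← {s = s} w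
  into _ (inj₂ (inj₁ (w , u , refl))) = uses-tail← {w = w} u
  into _ (inj₂ (inj₂ (w , u , refl))) = uses-avoid← {w = w} u
  back : ∀ v → UsesOnly (suc p) v → Image head-first (SubWithin p) v ⊎ (Image tail-first (UsesOnly p) v ⊎ Image avoid-first (UsesOnly p) v)
  back v u with vertex-view v
  ... | headed s  = inj₁ (s , uses-head→ {s = s} u , refl)
  ... | tailed w  = inj₂ (inj₁ (w , uses-tail→ {w = w} u , refl))
  ... | avoided w = inj₂ (inj₂ (w , uses-avoid→ {w = w} u , refl))
  a = p C suc k
  b = p C suc (suc k)
  count : a + (suc k * a + suc (suc k) * b) ≡ suc (suc k) * (suc p C suc (suc k))
  count = trans (collect k a b) (cong (suc (suc k) *_) (sym (pascal p (suc k))))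
    where
    collect : ∀ k a b → a + (suc k * a + suc (suc k) * b) ≡ suc (suc k) * (a + b)
    collect = solve-∀

same-label : ∀ {n j} {a b : Fin n} → toℕ a + 1 ≡ j → toℕ b + 1 ≡ j → a ≡ b
same-label {a = a} {b} ea eb = toℕ-injective (+-cancelʳ-≡ 1 (toℕ a) (toℕ b) (trans ea (sym eb)))

tail-contains-first : ∀ n m k → m ≤ n →
                      Enum {Vertex (suc n) (suc k)} (TSet (suc m) 1) (suc k * (m C suc k))
tail-contains-first n m k m≤n =
  enum-cong (enum-image tail-first tail-first-injective (vertices-within n m k m≤n)) into back refl
  where
  into : ∀ v → Image tail-first (UsesOnly m) v → TSet (suc m) 1 v
  into _ (w , u , refl) = uses-tail← {w = w} u , Fin.zero , here , refl
  back : ∀ v → TSet (suc m) 1 v → Image tail-first (UsesOnly m) v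
  back v (u , x , x∈T , label) with vertex-view v | same-label {b = Fin.zero} label refl
  ... | headed _  | refl with x∈T
  ...   | ()
  back v (u , x , x∈T , label) | tailed w | refl = w , uses-tail→ {w = w} u , refl
  back v (u , x , x∈T , label) | avoided _ | refl with x∈T
  ...   | ()

-- |𝓗_{j+1}(j+1)| = C(j,k): the head is j+1 and the tail is any k-subset of [j].
head-is-last : ∀ n j k → j < n → Enum {Vertex n k} (HSet (suc j) (suc j)) (j C k)
head-is-last (suc n) zero k _ =
  enum-cong (enum-image head-first head-first-injective (subsets-within n 0 k z≤n)) into back refl
  where
  into : ∀ v → Image head-first (SubWithin 0) v → HSet 1 1 v
  into _ (s , w , refl) = uses-head← {s = s} w , refl
  back : ∀ v → HSet 1 1 v → Image head-first (SubWithin 0) v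
  back v (u , label) with vertex-view v
  ... | headed s = s , uses-head→ {s = s} u , refl
  ... | tailed w with same-label {a = Fin.suc (h w)} {b = Fin.zero} label refl
  ...   | ()
  back v (u , label) | avoided w with same-label {a = Fin.suc (h w)} {b = Fin.zero} label refl
  ...   | ()
head-is-last (suc n) (suc j) zero (s≤s j<n) =
  enum-cong (enum-image avoid-first avoid-first-injective (head-is-last n j zero j<n)) into back refl
  where
  into : ∀ v → Image avoid-first (HSet (suc j) (suc j)) v → HSet (suc (suc j)) (suc (suc j)) v
  into _ (w , (u , label) , refl) = uses-avoid← {w = w} u , cong suc label
  back : ∀ v → HSet (suc (suc j)) (suc (suc j)) v → Image avoid-first (HSet (suc j) (suc j)) v
  back v (u , label) with vertex-view v
  ... | headed _ with label
  ...   | ()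
  back v (u , label) | avoided w = w , (uses-avoid→ {w = w} u , suc-injective label) , refl
head-is-last (suc n) (suc j) (suc k) (s≤s j<n) =
  enum-cong (enum-⊎ disjoint (enum-image tail-first tail-first-injective (head-is-last n j k j<n))
                             (enum-image avoid-first avoid-first-injective (head-is-last n j (suc k) j<n)))
            into back (nCk+nC[k+1]≡[n+1]C[k+1] j k)
  where
  Last : ∀ {k′} → Vertex n k′ → Set
  Last = HSet (suc j) (suc j)
  disjoint : ∀ v → Image tail-first Last v → Image avoid-first Last v → ⊥
  disjoint _ (_ , _ , refl) (_ , _ , e) = tail≢avoid e
  into : ∀ v → Image tail-first Last v ⊎ Image avoid-first Last v → HSet (suc (suc j)) (suc (suc j)) v
  into _ (inj₁ (w , (u , label) , refl)) = uses-tail← {w = w} u , cong suc label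
  into _ (inj₂ (w , (u , label) , refl)) = uses-avoid← {w = w} u , cong suc label
  back : ∀ v → HSet (suc (suc j)) (suc (suc j)) v → Image tail-first Last v ⊎ Image avoid-first Last v
  back v (u , label) with vertex-view v
  ... | headed _ with label
  ...   | ()
  back v (u , label) | tailed w  = inj₁ (w , (uses-tail→ {w = w} u , suc-injective label) , refl)
  back v (u , label) | avoided w = inj₂ (w , (uses-avoid→ {w = w} u , suc-injective label) , refl)

label-≤ : ∀ {n i i′} {a : Fin n} → toℕ a + 1 ≡ i → toℕ a < i′ → i ≤ i′
label-≤ {a = a} label a<i′ = subst (_≤ _) (trans (+-comm 1 (toℕ a)) label) a<i′

-- Vertices whose tails share an element j are never adjacent, so 𝓣_m(j) is independent.
sharing-tails-independent : ∀ {n r} m j → Independent {n} {r} (TSet m j)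
sharing-tails-independent m j x y (_ , a , a∈Tx , la) (_ , b , b∈Ty , lb) (_ , _ , disjoint) =
  disjoint (a , x∈p∩q⁺ (a∈Tx , subst (_∈ T y) (same-label lb la) b∈Ty))

Layered : ∀ {n r} → ℕ → ℕ → Vertex n r → Set
Layered R j v = Σ ℕ (λ i → (R + 1 ≤ i) × (i ≤ j) × HSet i i v) ⊎ TSet R 1 v

-- Layered R j is independent: two adjacent vertices of ⋃ 𝓗_i(i) would need each head in
-- the other's tail, forcing equal heads; a vertex of 𝓗_i(i), i > R, has its head outside
-- every tail contained in [R]; and 𝓣_R(1) is independent.
layered-independent : ∀ {n r} R j → Independent {n} {r} (Layered R j)
layered-independent R j x y (inj₁ (i , _ , _ , ux , lx)) (inj₁ (i′ , _ , _ , uy , ly)) (hx∈Ty , hy∈Tx , _)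
  with ≤-antisym (label-≤ lx (proj₂ uy (h x) hx∈Ty)) (label-≤ ly (proj₂ ux (h y) hy∈Tx))
... | refl with []=-injective (subst (λ z → T y [ z ]= inside) (same-label lx ly) hx∈Ty) (h∉T y)
...   | ()
layered-independent R j x y (inj₁ (i , R<i , _ , _ , lx)) (inj₂ (uy , _)) (hx∈Ty , _ , _) =
  m+1+n≰m R (≤-trans R<i (label-≤ lx (proj₂ uy (h x) hx∈Ty)))
layered-independent R j x y (inj₂ (ux , _)) (inj₁ (i , R<i , _ , _ , ly)) (_ , hy∈Tx , _) =
  m+1+n≰m R (≤-trans R<i (label-≤ ly (proj₂ ux (h y) hy∈Tx)))
layered-independent R j x y (inj₂ tx) (inj₂ ty) = sharing-tails-independent R 1 x y tx ty

-- If F(R) counts 𝓣_R(1) and F(j+1) = F(j) + C(j,k), then F(j) counts Layered R j: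
-- passing from j to j+1 adds the disjoint layer 𝓗_{j+1}(j+1) of size C(j,k).
layered-count : ∀ {n k} R (F : ℕ → ℕ) → Enum {Vertex n k} (TSet R 1) (F R) →
                (∀ j → R ≤ j → j < n → F (suc j) ≡ F j + j C k) →
                ∀ {j} → R ≤′ j → j ≤ n → Enum {Vertex n k} (Layered R j) (F j)
layered-count R F base grow ≤′-refl _ = enum-cong base (λ _ → inj₂) only-tails refl
  where
  only-tails : ∀ v → Layered R R v → TSet R 1 v
  only-tails _ (inj₁ (i , R<i , i≤R , _)) = ⊥-elim (m+1+n≰m R (≤-trans R<i i≤R))
  only-tails _ (inj₂ t) = t
layered-count {n} {k} R F base grow {suc j} (≤′-step R≤′j) j<n =
  enum-cong (enum-⊎ disjoint (layered-count R F base grow R≤′j (≤-trans (n≤1+n j) j<n)) (head-is-last n j k j<n))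
            into back (sym (grow j R≤j j<n))
  where
  R≤j = ≤′⇒≤ R≤′j
  disjoint : ∀ v → Layered R j v → HSet (suc j) (suc j) v → ⊥
  disjoint _ (inj₁ (i , _ , i≤j , _ , li)) (_ , l) = n≮n j (≤-trans (≤-reflexive (trans (sym l) li)) i≤j)
  disjoint _ (inj₂ (u , _)) (_ , l) = n≮n j (≤-trans (label-≤ l (proj₁ u)) R≤j)
  into : ∀ v → Layered R j v ⊎ HSet (suc j) (suc j) v → Layered R (suc j) v
  into _ (inj₁ (inj₁ (i , R<i , i≤j , hi))) = inj₁ (i , R<i , m≤n⇒m≤1+n i≤j , hi)
  into _ (inj₁ (inj₂ t)) = inj₂ t
  into _ (inj₂ hj) = inj₁ (suc j , subst (_≤ suc j) (+-comm 1 R) (s≤s R≤j) , ≤-refl , hj)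
  back : ∀ v → Layered R (suc j) v → Layered R j v ⊎ HSet (suc j) (suc j) v
  back _ (inj₁ (i , R<i , i≤1+j , hi)) with m≤n⇒m<n∨m≡n i≤1+j
  ... | inj₁ i<1+j = inj₁ (inj₁ (i , R<i , ≤-pred i<1+j , hi))
  ... | inj₂ refl  = inj₂ hi
  back _ (inj₂ t) = inj₁ (inj₂ t)

mainTheorem12 : (r : ℕ) → 2 ≤ r →
    ((n : ℕ) → 2 * r ≤ n → n ≤ r ^ 2 + 1 →
      (α' r n ≡ r * ((n ∸ 1) C r))
      × Independent {n} {r} (TSet n 1)
      × HasSize {n} {r} (TSet n 1) (r * ((n ∸ 1) C r)))
    ×
    ((n : ℕ) → r ^ 2 ≤ n →
      ((r + 1) * α' r n ≡ (r + 1) * (n C (r + 1)) + (r ∸ 1) * ((r ^ 2) C r))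
      × Independent {n} {r} (λ v → Σ ℕ (λ i → (r ^ 2 + 1 ≤ i) × (i ≤ n) × HSet i i v) ⊎ TSet (r ^ 2) 1 v)
      × HasSize {n} {r} (λ v → Σ ℕ (λ i → (r ^ 2 + 1 ≤ i) × (i ≤ n) × HSet i i v) ⊎ TSet (r ^ 2) 1 v) (α' r n))
mainTheorem12 (suc (suc t)) (s≤s (s≤s z≤n)) = up-to-square , from-square
  where
  open AboveSquare t

  up-to-square : (n : ℕ) → 2 * r ≤ n → n ≤ r ^ 2 + 1 →
    (α' r n ≡ r * ((n ∸ 1) C r)) × Independent {n} {r} (TSet n 1) × HasSize {n} {r} (TSet n 1) (r * ((n ∸ 1) C r))
  -- n ≥ 2r > 0, so n = m + 1 (the case n = 0 is absurd).
  up-to-square (suc m) 2r≤n n≤ =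
    α'-up-to-square s (suc m) 2r≤n n≤ , sharing-tails-independent (suc m) 1 , tail-contains-first m m s ≤-refl

  from-square : (n : ℕ) → r ^ 2 ≤ n →
    ((r + 1) * α' r n ≡ (r + 1) * (n C (r + 1)) + (r ∸ 1) * ((r ^ 2) C r))
    × Independent {n} {r} (Layered (r ^ 2) n) × HasSize {n} {r} (Layered (r ^ 2) n) (α' r n)
  -- likewise n ≥ r² > 0.
  from-square (suc m) r²≤n =
    α'-above-square (suc m) r²≤n , layered-independent (r ^ 2) (suc m) ,
    layered-count (r ^ 2) (α' r) square-tails (λ j r²≤j _ → α'-grows j r²≤j) (≤⇒≤′ r²≤n) ≤-refl
    where
    -- |𝓣_{r²}(1)| = r·C(r²−1, r) = α'(r²).
    square-tails : Enum {Vertex (suc m) r} (TSet (r ^ 2) 1) (α' r (r ^ 2))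
    square-tails = subst (λ R → Enum {Vertex (suc m) r} (TSet R 1) (α' r R)) (sym (square-suc s))
      (enum-cong (tail-contains-first m M s (≤-pred (subst (_≤ suc m) (square-suc s) r²≤n)))
                 (λ _ u → u) (λ _ u → u) (sym α'-at-square))
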